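{- Let $\mathcal{H}$ be a connected $m$-uniform hypergraph with vertices $u\ne v$ such that $d_{\mathcal{H}}(u)>1$ and $d_{\mathcal{H}}(u)\ge d_{\mathcal{H}}(v)$. Let $\mathcal{T}_1,\mathcal{T}_2$ be binary $m$-uniform hypertrees (disjoint from each other and from $\mathcal{H}$) with $|E(\mathcal{T}_1)|>0$. Let $\mathcal{H}_1$ be obtained by identifying $u$ with a pendent vertex $u_0$ of $\mathcal{T}_1$, lying in the edge $e_0$ of $\mathcal{T}_1$, and identifying $v$ with a pendent vertex $v_0$ of $\mathcal{T}_2$. Let $v_t\in V(\mathcal{T}_2)$ be a pendent vertex of $\mathcal{H}_1$, and let $\mathcal{H}_2$ be obtained from $\mathcal{H}_1$ by deleting $e_0$ and adding $(e_0\setminus\{u\})\cup\{v_t\}$. Then: (1) if $|E(\mathcal{T}_2)|>0$, then $M(\mathcal{H}_1)>M(\mathcal{H}_2)$; (2) if $|E(\mathcal{T}_2)|=0$ and $d_{\mathcal{H}}(u)>d_{\mathcal{H}}(v)$, then $M(\mathcal{H}_1)>M(\mathcal{H}_2)$.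
   Context: $d_{\mathcal{H}}(w)$ is the degree of vertex $w$ (number of edges containing it). An $m$-uniform hypertree is a connected $m$-uniform hypergraph with no (Berge) hypercycle; it is binary if its maximum degree is at most $2$; a hypertree with no edges is a single vertex. A core vertex is a vertex of degree one; a pendent edge is an edge $f$ containing $|f|-1$ core vertices; a pendent vertex is a core vertex in a pendent edge. The Zagreb index $M(\mathcal{H})$ is the sum of the squares of the degrees of all vertices. -}

module Defs where

open import Data.Nat using (ℕ; zero; suc; _+_; _*_; _∸_; _≤_; _<_)
open import Data.Bool using (Bool)
import Data.Bool as Bool
open import Data.Fin using (Fin; zero; suc; inject₁; fromℕ)
open import Data.Fin.Subset using (Subset; _∈_; ⁅_⁆; _∪_; _-_; ∣_∣; ⋃)
open import Data.Fin.Subset.Properties using (_∈?_)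
open import Data.Nat.ListAction using (sum)
open import Data.List using (List; length; filter; map; allFin; lookup; _∷_; _++_)
open import Data.List.Relation.Unary.All using (All)
import Data.List.Membership.Propositional as LM
open import Data.Vec.Properties using (≡-dec)
open import Data.Product using (Σ; ∃; _×_; _,_)
open import Data.Empty using (⊥)
import Data.Sum
open import Relation.Nullary using (¬_; Dec; yes; no; ¬?)
open import Relation.Nullary.Decidable using (_×-dec_)
open import Relation.Binary.PropositionalEquality using (_≡_; _≢_)
open import Function.Definitions using (Injective)

Hypergraph : ℕ → Set
Hypergraph n = List (Subset n)

_∈ₑ_ : ∀ {n} → Subset n → Hypergraph n → Set
e ∈ₑ E = e LM.∈ E

_≟ₛ_ : ∀ {n} (a b : Subset n) → Dec (a ≡ b)
_≟ₛ_ = ≡-dec Bool._≟_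

deg : ∀ {n} → Hypergraph n → Fin n → ℕ
deg E w = length (filter (λ e → w ∈? e) E)

Zagreb : ∀ {n} → Hypergraph n → ℕ
Zagreb {n} E = sum (map (λ w → deg E w * deg E w) (allFin n))

Uniform : ∀ {n} → ℕ → Hypergraph n → Set
Uniform m E = All (λ e → ∣ e ∣ ≡ m) E

data Walk {n} (E : Hypergraph n) : Fin n → Fin n → Set where
  here : ∀ {x} → Walk E x x
  step : ∀ {x z y} (e : Subset n) → e ∈ₑ E → x ∈ e → z ∈ e → Walk E z y → Walk E x y

Connected : ∀ {n} → Hypergraph n → Set
Connected {n} E = (x y : Fin n) → Walk E x y

-- Berge hypercycle of length k = j+2 ≥ 2: distinct vertices v₀..v_{k-1} and distinct
-- edges (distinct positions in the edge list) e₀..e_{k-1} with v_i, v_{i+1 mod k} ∈ e_i.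
record BergeCycle {n} (E : Hypergraph n) : Set where
  field
    j  : ℕ
    vs : Fin (suc (suc j)) → Fin n
    es : Fin (suc (suc j)) → Fin (length E)
    vs-inj : Injective _≡_ _≡_ vs
    es-inj : Injective _≡_ _≡_ es
    v∈e    : ∀ i → vs i ∈ lookup E (es i)
    vnext∈e : ∀ (i : Fin (suc j)) → vs (suc i) ∈ lookup E (es (inject₁ i))
    vwrap∈e : vs zero ∈ lookup E (es (fromℕ (suc j)))

Hypertree : ∀ {n} → ℕ → Hypergraph n → Set
Hypertree m E = Connected E × Uniform m E × ¬ BergeCycle E

Binary : ∀ {n} → Hypergraph n → Set
Binary {n} E = (w : Fin n) → deg E w ≤ 2

Core : ∀ {n} → Hypergraph n → Fin n → Set
Core E w = deg E w ≡ 1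

coreCount : ∀ {n} → Hypergraph n → Subset n → ℕ
coreCount {n} E f = length (filter (λ w → (w ∈? f) ×-dec (deg E w Data.Nat.≟ 1)) (allFin n))

PendentEdge : ∀ {n} → Hypergraph n → Subset n → Set
PendentEdge E f = f ∈ₑ E × coreCount E f ≡ ∣ f ∣ ∸ 1

PendentVertex : ∀ {n} → Hypergraph n → Fin n → Set
PendentVertex {n} E w = Core E w × Σ (Subset n) (λ f → PendentEdge E f × w ∈ f)

image : ∀ {a b} → (Fin a → Fin b) → Subset a → Subset b
image {a} f s = ⋃ (map (λ x → ⁅ f x ⁆) (filter (λ x → x ∈? s) (allFin a)))

-- IsGluing N n n₁ n₂ ι ι₁ ι₂ u v u₀ v₀ : the maps ι, ι₁, ι₂ into Fin N exhibit Fin N as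
-- the vertex set obtained from disjoint copies of Fin n, Fin n₁, Fin n₂ by identifying
-- u with u₀ and v with v₀ (and nothing else).
record IsGluing {N n n₁ n₂ : ℕ} (ι : Fin n → Fin N) (ι₁ : Fin n₁ → Fin N) (ι₂ : Fin n₂ → Fin N)
                (u v : Fin n) (u₀ : Fin n₁) (v₀ : Fin n₂) : Set where
  field
    ι-inj  : Injective _≡_ _≡_ ι
    ι₁-inj : Injective _≡_ _≡_ ι₁
    ι₂-inj : Injective _≡_ _≡_ ι₂
    glue₁  : ι₁ u₀ ≡ ι u
    glue₂  : ι₂ v₀ ≡ ι v
    only₁  : ∀ x y → ι₁ x ≡ ι y → x ≡ u₀
    only₂  : ∀ x y → ι₂ x ≡ ι y → x ≡ v₀
    disj₁₂ : ∀ x y → ι₁ x ≡ ι₂ y → ⊥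
    cover  : ∀ z → ∃ (λ x → ι x ≡ z) Data.Sum.⊎ (∃ (λ x → ι₁ x ≡ z) Data.Sum.⊎ ∃ (λ x → ι₂ x ≡ z))

glueEdges : ∀ {N n n₁ n₂} → (Fin n → Fin N) → (Fin n₁ → Fin N) → (Fin n₂ → Fin N)
          → Hypergraph n → Hypergraph n₁ → Hypergraph n₂ → Hypergraph N
glueEdges ι ι₁ ι₂ E E₁ E₂ = map (image ι) E ++ (map (image ι₁) E₁ ++ map (image ι₂) E₂)

replaceEdge : ∀ {N} → Hypergraph N → Subset N → Subset N → Hypergraph N
replaceEdge E f g = g ∷ filter (λ e → ¬? (e ≟ₛ f)) E

-- Let f be the copy of e₀ in ℋ₁, c ≥ 1 its multiplicity, and D the degree in ℋ₁ with every copy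
-- of f removed. Passing to ℋ₂ lowers the degree of u from D u + c to D u, raises that of vₜ from
-- D vₜ to D vₜ + 1, and raises no other degree. Hence M(ℋ₁) − M(ℋ₂) ≥ (2 D u + 1) − (2 D vₜ + 1),
-- which is positive: D vₜ = 1 as vₜ is pendent and outside f, while D u ≥ d(u) ≥ 2 because no
-- edge of ℋ is a copy of f (e₀ has m ≥ 2 vertices, and those other than u₀ are not in ℋ).
module Submission where

open import Defs
open import Data.Bool.Base using (if_then_else_)
open import Data.Fin as Fin using (Fin; zero; suc)
open import Data.Fin.Properties using (any?)
open import Data.Fin.Subset using (Subset; _∈_; _∉_; ⁅_⁆; _∪_; _-_; _─_; ⋃; ∣_∣; _⊆_; inside; outside)
open import Data.Fin.Subset.Properties
open import Data.List using (List; []; _∷_; length; filter; map; allFin; _++_)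
open import Data.List.Properties using (length-++; filter-++; filter-all; map-tabulate)
import Data.List.Membership.Propositional as LM
open import Data.List.Membership.Propositional.Properties
  using (∈-map⁺; ∈-map⁻; ∈-filter⁺; ∈-filter⁻; ∈-allFin; ∈-++⁺ˡ; ∈-++⁺ʳ)
open import Data.List.Relation.Unary.All as All using (All)
open import Data.List.Relation.Unary.All.Properties using (map⁺)
open import Data.List.Relation.Unary.Any using (here; there)
open import Data.List.Relation.Unary.Unique.Propositional using (Unique)
open import Data.Nat using (ℕ; suc; _+_; _*_; _<_; _≤_; z≤n; s≤s; NonZero; >-nonZero)
open import Data.Nat.ListAction using (sum)
open import Data.Nat.Properties
open import Data.Nat.Tactic.RingSolver using (solve-∀)
open import Algebra.Properties.CommutativeSemigroup +-commutativeSemigroup using (interchange)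
open import Data.Product using (∃; _×_; _,_; proj₂)
open import Data.Sum using (inj₁; inj₂)
open import Data.Vec using (_∷_; here; there)
open import Function.Base using (_∘_)
open import Relation.Nullary using (¬_; Dec; yes; no; ¬?; does; contradiction)
open import Relation.Nullary.Decidable using (_×-dec_; dec-true; dec-false)
open import Relation.Binary.PropositionalEquality

𝟙 : ∀ {p} {P : Set p} → Dec P → ℕ
𝟙 P? = if does P? then 1 else 0

𝟙-yes : ∀ {p} {P : Set p} (P? : Dec P) → P → 𝟙 P? ≡ 1
𝟙-yes P? p = cong (if_then 1 else 0) (dec-true P? p)

𝟙-no : ∀ {p} {P : Set p} (P? : Dec P) → ¬ P → 𝟙 P? ≡ 0
𝟙-no P? ¬p = cong (if_then 1 else 0) (dec-false P? ¬p)

𝟙-mono : ∀ {p q} {P : Set p} {Q : Set q} (P? : Dec P) (Q? : Dec Q) → (P → Q) → 𝟙 P? ≤ 𝟙 Q?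
𝟙-mono P? Q? P⇒Q with P? | Q?
... | yes _ | yes _ = ≤-refl
... | yes p | no ¬q = contradiction (P⇒Q p) ¬q
... | no _  | _     = z≤n

module _ {a} {A : Set a} where

  sum-map-+ : ∀ (f g : A → ℕ) xs → sum (map (λ x → f x + g x) xs) ≡ sum (map f xs) + sum (map g xs)
  sum-map-+ f g []       = refl
  sum-map-+ f g (x ∷ xs) = begin
    f x + g x + sum (map (λ x → f x + g x) xs)       ≡⟨ cong (f x + g x +_) (sum-map-+ f g xs) ⟩
    f x + g x + (sum (map f xs) + sum (map g xs))    ≡⟨ interchange (f x) (g x) _ _ ⟩
    f x + sum (map f xs) + (g x + sum (map g xs))    ∎
    where open ≡-Reasoning

  sum-map-mono-≤ : ∀ {f g : A → ℕ} → (∀ x → f x ≤ g x) → ∀ xs → sum (map f xs) ≤ sum (map g xs)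
  sum-map-mono-≤ f≤g []       = z≤n
  sum-map-mono-≤ f≤g (x ∷ xs) = +-mono-≤ (f≤g x) (sum-map-mono-≤ f≤g xs)

sum-allFin-suc : ∀ {n} (h : Fin (suc n) → ℕ) → sum (map h (allFin (suc n))) ≡ h zero + sum (map (λ w → h (suc w)) (allFin n))
sum-allFin-suc {n} h = cong (λ ws → h zero + sum ws)
  (trans (map-tabulate suc h) (sym (map-tabulate (λ w → w) (λ w → h (suc w)))))

sum-allFin-𝟙 : ∀ {n} (a : Fin n) k → sum (map (λ w → 𝟙 (w Fin.≟ a) * k) (allFin n)) ≡ k
sum-allFin-𝟙 {suc n} zero    k = begin
  sum (map (λ w → 𝟙 (w Fin.≟ zero) * k) (allFin (suc n)))  ≡⟨ sum-allFin-suc {n} (λ w → 𝟙 (w Fin.≟ zero) * k) ⟩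
  1 * k + sum (map (λ _ → 0) (allFin n))                    ≡⟨ cong₂ _+_ (*-identityˡ k) (sum-map-zero (allFin n)) ⟩
  k + 0                                                     ≡⟨ +-identityʳ k ⟩
  k                                                         ∎
  where
  open ≡-Reasoning
  sum-map-zero : ∀ (ws : List (Fin n)) → sum (map (λ _ → 0) ws) ≡ 0
  sum-map-zero []       = refl
  sum-map-zero (_ ∷ ws) = sum-map-zero ws
sum-allFin-𝟙 {suc n} (suc a) k = trans (sum-allFin-suc {n} (λ w → 𝟙 (w Fin.≟ suc a) * k)) (sum-allFin-𝟙 a k)

sum-allFin-< : ∀ {n} (p q : Fin n → ℕ) {a b : Fin n} {α β : ℕ} → a ≢ b → β < α
  → p a + α ≤ q a → p b ≤ q b + β → (∀ w → w ≢ a → w ≢ b → p w ≤ q w)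
  → sum (map p (allFin n)) < sum (map q (allFin n))
sum-allFin-< {n} p q {a} {b} {α} {β} a≢b β<α pa+α≤qa pb≤qb+β p≤q = +-cancelʳ-< _ _ _ (begin-strict
  Σp + β                  <⟨ +-monoʳ-< Σp β<α ⟩
  Σp + α                  ≡⟨ cong (Σp +_) (sum-allFin-𝟙 a α) ⟨
  Σp + sum (map δa ws)    ≡⟨ sum-map-+ p δa ws ⟨
  sum (map (λ w → p w + δa w) ws)  ≤⟨ sum-map-mono-≤ pointwise ws ⟩
  sum (map (λ w → q w + δb w) ws)  ≡⟨ sum-map-+ q δb ws ⟩
  Σq + sum (map δb ws)    ≡⟨ cong (Σq +_) (sum-allFin-𝟙 b β) ⟩
  Σq + β                  ∎)
  where
  open ≤-Reasoning
  ws = allFin n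
  Σp = sum (map p ws)
  Σq = sum (map q ws)
  δa δb : Fin n → ℕ
  δa w = 𝟙 (w Fin.≟ a) * α
  δb w = 𝟙 (w Fin.≟ b) * β
  pointwise : ∀ w → p w + 𝟙 (w Fin.≟ a) * α ≤ q w + 𝟙 (w Fin.≟ b) * β
  pointwise w with w Fin.≟ a | w Fin.≟ b
  ... | yes refl | yes refl = contradiction refl a≢b
  ... | yes refl | no _     = ≤-trans (≤-reflexive (cong (_ +_) (+-identityʳ α))) (≤-trans pa+α≤qa (m≤m+n _ 0))
  ... | no _     | yes refl = ≤-trans (≤-reflexive (+-identityʳ _)) (≤-trans pb≤qb+β (≤-reflexive (cong (_ +_) (sym (+-identityʳ β)))))
  ... | no w≢a   | no w≢b   = ≤-trans (≤-reflexive (+-identityʳ (p w))) (≤-trans (p≤q w w≢a w≢b) (m≤m+n (q w) 0))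

x∈p─q⇒x∉q : ∀ {n} (p q : Subset n) {x} → x ∈ p ─ q → x ∉ q
x∈p─q⇒x∉q (_ ∷ p) (outside ∷ q) here      ()
x∈p─q⇒x∉q (_ ∷ p) (inside  ∷ q) ()        here
x∈p─q⇒x∉q (_ ∷ p) (_       ∷ q) (there a) (there b) = x∈p─q⇒x∉q p q a b

x∈p-y⇒x≢y : ∀ {n} (p : Subset n) {x y} → x ∈ p - y → x ≢ y
x∈p-y⇒x≢y p {x} x∈p-y refl = x∈p─q⇒x∉q p ⁅ x ⁆ x∈p-y (x∈⁅x⁆ x)

x∈p∧y∈p∧x≢y⇒2≤∣p∣ : ∀ {n} {p : Subset n} {x y} → x ∈ p → y ∈ p → x ≢ y → 2 ≤ ∣ p ∣
x∈p∧y∈p∧x≢y⇒2≤∣p∣ {p = p} {x} {y} x∈p y∈p x≢y = begin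
  2                ≡⟨ cong suc (∣⁅x⁆∣≡1 y) ⟨
  suc ∣ ⁅ y ⁆ ∣    ≤⟨ s≤s (p⊆q⇒∣p∣≤∣q∣ ⁅y⁆⊆p-x) ⟩
  suc ∣ p - x ∣    ≤⟨ x∈p⇒∣p-x∣<∣p∣ x∈p ⟩
  ∣ p ∣            ∎
  where
  open ≤-Reasoning
  ⁅y⁆⊆p-x : ⁅ y ⁆ ⊆ p - x
  ⁅y⁆⊆p-x z∈⁅y⁆ with refl ← x∈⁅y⁆⇒x≡y y z∈⁅y⁆ = x∈p∧x≢y⇒x∈p-y y∈p (x≢y ∘ sym)

2≤∣p∣⇒∃x∈p∧x≢y : ∀ {n} {p : Subset n} → 2 ≤ ∣ p ∣ → ∀ y → ∃ λ x → x ∈ p × x ≢ y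
2≤∣p∣⇒∃x∈p∧x≢y {p = p} 2≤∣p∣ y with any? (λ x → (x ∈? p) ×-dec ¬? (x Fin.≟ y))
... | yes other = other
... | no ∄other = contradiction (p⊆q⇒∣p∣≤∣q∣ p⊆⁅y⁆) (<⇒≱ (subst (_< ∣ p ∣) (sym (∣⁅x⁆∣≡1 y)) 2≤∣p∣))
  where
  p⊆⁅y⁆ : p ⊆ ⁅ y ⁆
  p⊆⁅y⁆ {x} x∈p with x Fin.≟ y
  ... | yes refl = x∈⁅x⁆ y
  ... | no x≢y   = contradiction (x , x∈p , x≢y) ∄other

⋃⁺ : ∀ {n} {x : Fin n} {p : Subset n} (ps : List (Subset n)) → p LM.∈ ps → x ∈ p → x ∈ ⋃ ps
⋃⁺ (q ∷ ps) (here refl) x∈p = p⊆p∪q (⋃ ps) x∈p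
⋃⁺ (q ∷ ps) (there p∈ps) x∈p = q⊆p∪q q (⋃ ps) (⋃⁺ ps p∈ps x∈p)

⋃⁻ : ∀ {n} {x : Fin n} (ps : List (Subset n)) → x ∈ ⋃ ps → ∃ λ p → p LM.∈ ps × x ∈ p
⋃⁻ []       x∈⋃ = contradiction x∈⋃ ∉⊥
⋃⁻ (q ∷ ps) x∈⋃ with x∈p∪q⁻ q (⋃ ps) x∈⋃
... | inj₁ x∈q = q , here refl , x∈q
... | inj₂ x∈⋃ps with p , p∈ps , x∈p ← ⋃⁻ ps x∈⋃ps = p , there p∈ps , x∈p

module _ {a b} (h : Fin a → Fin b) (s : Subset a) where

  private
    images : List (Subset b)
    images = map (λ x → ⁅ h x ⁆) (filter (_∈? s) (allFin a))

  image⁺ : ∀ {x} → x ∈ s → h x ∈ image h s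
  image⁺ {x} x∈s = ⋃⁺ images (∈-map⁺ (λ x → ⁅ h x ⁆) (∈-filter⁺ (_∈? s) (∈-allFin x) x∈s)) (x∈⁅x⁆ (h x))

  image⁻ : ∀ {z} → z ∈ image h s → ∃ λ x → x ∈ s × h x ≡ z
  image⁻ z∈ with _ , p∈images , z∈p ← ⋃⁻ images z∈
            with x , x∈filter , refl ← ∈-map⁻ (λ x → ⁅ h x ⁆) {xs = filter (_∈? s) (allFin a)} p∈images
    = x , proj₂ (∈-filter⁻ (_∈? s) {xs = allFin a} x∈filter) , sym (x∈⁅y⁆⇒x≡y _ z∈p)

dropEdge : ∀ {n} → Subset n → Hypergraph n → Hypergraph n
dropEdge f = filter (λ e → ¬? (e ≟ₛ f))

multiplicity : ∀ {n} → Subset n → Hypergraph n → ℕ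
multiplicity f E = length (filter (_≟ₛ f) E)

multiplicity-pos : ∀ {n} {f : Subset n} (E : Hypergraph n) → f ∈ₑ E → 0 < multiplicity f E
multiplicity-pos {f = f} (e ∷ E) e∈ with e ≟ₛ f | e∈
... | yes _  | _          = s≤s z≤n
... | no e≢f | here e≡f   = contradiction (sym e≡f) e≢f
... | no _   | there f∈E = multiplicity-pos E f∈E

deg-∷ : ∀ {n} (e : Subset n) E w → deg (e ∷ E) w ≡ 𝟙 (w ∈? e) + deg E w
deg-∷ e E w with w ∈? e
... | yes _ = refl
... | no _  = refl

deg-++ : ∀ {n} (E F : Hypergraph n) w → deg (E ++ F) w ≡ deg E w + deg F w
deg-++ E F w = trans (cong length (filter-++ (w ∈?_) E F)) (length-++ (filter (w ∈?_) E))

deg-dropEdge : ∀ {n} (f : Subset n) E w → deg E w ≡ deg (dropEdge f E) w + 𝟙 (w ∈? f) * multiplicity f E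
deg-dropEdge f []       w = sym (*-zeroʳ (𝟙 (w ∈? f)))
deg-dropEdge f (e ∷ E) w with e ≟ₛ f | deg-dropEdge f E w
... | no _     | ih = begin
  deg (e ∷ E) w                                          ≡⟨ deg-∷ e E w ⟩
  𝟙 (w ∈? e) + deg E w                                   ≡⟨ cong (𝟙 (w ∈? e) +_) ih ⟩
  𝟙 (w ∈? e) + (deg (dropEdge f E) w + 𝟙 (w ∈? f) * c)   ≡⟨ +-assoc (𝟙 (w ∈? e)) _ _ ⟨
  𝟙 (w ∈? e) + deg (dropEdge f E) w + 𝟙 (w ∈? f) * c     ≡⟨ cong (_+ 𝟙 (w ∈? f) * c) (deg-∷ e (dropEdge f E) w) ⟨
  deg (e ∷ dropEdge f E) w + 𝟙 (w ∈? f) * c              ∎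
  where
  open ≡-Reasoning
  c = multiplicity f E
... | yes refl | ih = begin
  deg (e ∷ E) w                                          ≡⟨ deg-∷ e E w ⟩
  𝟙 (w ∈? e) + deg E w                                   ≡⟨ cong (𝟙 (w ∈? e) +_) ih ⟩
  𝟙 (w ∈? e) + (deg (dropEdge e E) w + 𝟙 (w ∈? e) * c)   ≡⟨ shift (𝟙 (w ∈? e)) (deg (dropEdge e E) w) c ⟩
  deg (dropEdge e E) w + 𝟙 (w ∈? e) * suc c              ∎
  where
  open ≡-Reasoning
  c = multiplicity e E
  shift : ∀ i d c → i + (d + i * c) ≡ d + i * suc c
  shift = solve-∀

deg-dropEdge-∉ : ∀ {n} {f : Subset n} (E : Hypergraph n) {w} → w ∉ f → deg (dropEdge f E) w ≡ deg E w
deg-dropEdge-∉ {f = f} E {w} w∉f = sym (begin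
  deg E w                                                         ≡⟨ deg-dropEdge f E w ⟩
  deg (dropEdge f E) w + 𝟙 (w ∈? f) * multiplicity f E            ≡⟨ cong (λ i → deg (dropEdge f E) w + i * multiplicity f E) (𝟙-no (w ∈? f) w∉f) ⟩
  deg (dropEdge f E) w + 0                                        ≡⟨ +-identityʳ _ ⟩
  deg (dropEdge f E) w                                            ∎)
  where open ≡-Reasoning

deg≤deg-dropEdge-++ : ∀ {n} {f : Subset n} {E : Hypergraph n} (F : Hypergraph n) → All (_≢ f) E
  → ∀ w → deg E w ≤ deg (dropEdge f (E ++ F)) w
deg≤deg-dropEdge-++ {f = f} {E} F E≢f w = begin
  deg E w                                              ≡⟨ cong (λ E′ → deg E′ w) (filter-all (λ e → ¬? (e ≟ₛ f)) E≢f) ⟨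
  deg (dropEdge f E) w                                 ≤⟨ m≤m+n _ _ ⟩
  deg (dropEdge f E) w + deg (dropEdge f F) w          ≡⟨ deg-++ (dropEdge f E) (dropEdge f F) w ⟨
  deg (dropEdge f E ++ dropEdge f F) w                 ≡⟨ cong (λ E′ → deg E′ w) (filter-++ (λ e → ¬? (e ≟ₛ f)) E F) ⟨
  deg (dropEdge f (E ++ F)) w                          ∎
  where open ≤-Reasoning

deg≤deg-map-image : ∀ {n N} (h : Fin n → Fin N) (E : Hypergraph n) w → deg E w ≤ deg (map (image h) E) (h w)
deg≤deg-map-image h []      w = z≤n
deg≤deg-map-image h (e ∷ E) w with w ∈? e | h w ∈? image h e
... | yes _   | yes _      = s≤s (deg≤deg-map-image h E w)
... | yes w∈e | no h[w]∉  = contradiction (image⁺ h e w∈e) h[w]∉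
... | no _    | yes _      = m≤n⇒m≤1+n (deg≤deg-map-image h E w)
... | no _    | no _       = deg≤deg-map-image h E w

walk⇒edge-of-size≥2 : ∀ {n} {E : Hypergraph n} {x y} → Walk E x y → x ≢ y → ∃ λ e → e ∈ₑ E × 2 ≤ ∣ e ∣
walk⇒edge-of-size≥2 here x≢x = contradiction refl x≢x
walk⇒edge-of-size≥2 {x = x} (step {z = z} e e∈E x∈e z∈e walk) x≢y with x Fin.≟ z
... | yes refl = walk⇒edge-of-size≥2 walk x≢y
... | no x≢z   = e , e∈E , x∈p∧y∈p∧x≢y⇒2≤∣p∣ x∈e z∈e x≢z

suc-square : ∀ x → suc x * suc x ≡ x * x + (x + suc x)
suc-square = solve-∀

zagreb-replaceEdge-< : ∀ {n} (G : Hypergraph n) {f : Subset n} {a b : Fin n}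
  → f ∈ₑ G → a ∈ f → b ∉ f → deg (dropEdge f G) b < deg (dropEdge f G) a
  → Zagreb (replaceEdge G f ((f - a) ∪ ⁅ b ⁆)) < Zagreb G
zagreb-replaceEdge-< G {f} {a} {b} f∈G a∈f b∉f Db<Da =
  sum-allFin-< (λ w → deg H w * deg H w) (λ w → deg G w * deg G w) a≢b
    (+-mono-< Db<Da (s≤s Db<Da)) at-a at-b elsewhere
  where
  g = (f - a) ∪ ⁅ b ⁆
  H = replaceEdge G f g
  D = deg (dropEdge f G)
  c = multiplicity f G
  instance
    c≢0 : NonZero c
    c≢0 = >-nonZero (multiplicity-pos G f∈G)

  a≢b : a ≢ b
  a≢b refl = b∉f a∈f

  a∉g : a ∉ g
  a∉g a∈g with x∈p∪q⁻ (f - a) ⁅ b ⁆ a∈g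
  ... | inj₁ a∈f-a = x∈p-y⇒x≢y f a∈f-a refl
  ... | inj₂ a∈⁅b⁆ = a≢b (x∈⁅y⁆⇒x≡y b a∈⁅b⁆)

  ∈g⇒∈f : ∀ {w} → w ≢ b → w ∈ g → w ∈ f
  ∈g⇒∈f w≢b w∈g with x∈p∪q⁻ (f - a) ⁅ b ⁆ w∈g
  ... | inj₁ w∈f-a = p─q⊆p f ⁅ a ⁆ w∈f-a
  ... | inj₂ w∈⁅b⁆ = contradiction (x∈⁅y⁆⇒x≡y b w∈⁅b⁆) w≢b

  degH : ∀ w → deg H w ≡ 𝟙 (w ∈? g) + D w
  degH = deg-∷ g (dropEdge f G)

  degG : ∀ w → deg G w ≡ D w + 𝟙 (w ∈? f) * c
  degG = deg-dropEdge f G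

  at-a : deg H a * deg H a + (D a + suc (D a)) ≤ deg G a * deg G a
  at-a = begin
    deg H a * deg H a + (D a + suc (D a))   ≡⟨ cong (λ d → d * d + (D a + suc (D a))) Ha≡Da ⟩
    D a * D a + (D a + suc (D a))           ≡⟨ suc-square (D a) ⟨
    suc (D a) * suc (D a)                   ≤⟨ *-mono-≤ suc[Da]≤Da+c suc[Da]≤Da+c ⟩
    (D a + c) * (D a + c)                   ≡⟨ cong (λ d → d * d) (sym Ga≡Da+c) ⟩
    deg G a * deg G a                       ∎
    where
    open ≤-Reasoning
    suc[Da]≤Da+c : suc (D a) ≤ D a + c
    suc[Da]≤Da+c = m<m+n (D a) (multiplicity-pos G f∈G)
    Ha≡Da : deg H a ≡ D a
    Ha≡Da = trans (degH a) (cong (_+ D a) (𝟙-no (a ∈? g) a∉g))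
    Ga≡Da+c : deg G a ≡ D a + c
    Ga≡Da+c = trans (degG a) (trans (cong (λ i → D a + i * c) (𝟙-yes (a ∈? f) a∈f)) (cong (D a +_) (*-identityˡ c)))

  at-b : deg H b * deg H b ≤ deg G b * deg G b + (D b + suc (D b))
  at-b = ≤-reflexive (begin
    deg H b * deg H b                      ≡⟨ cong (λ d → d * d) Hb≡1+Db ⟩
    suc (D b) * suc (D b)                  ≡⟨ suc-square (D b) ⟩
    D b * D b + (D b + suc (D b))          ≡⟨ cong (λ d → d * d + (D b + suc (D b))) (deg-dropEdge-∉ G b∉f) ⟩
    deg G b * deg G b + (D b + suc (D b))  ∎)
    where
    open ≡-Reasoning
    Hb≡1+Db : deg H b ≡ suc (D b)
    Hb≡1+Db = trans (degH b) (cong (_+ D b) (𝟙-yes (b ∈? g) (q⊆p∪q (f - a) ⁅ b ⁆ (x∈⁅x⁆ b))))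

  elsewhere : ∀ w → w ≢ a → w ≢ b → deg H w * deg H w ≤ deg G w * deg G w
  elsewhere w _ w≢b = *-mono-≤ Hw≤Gw Hw≤Gw
    where
    open ≤-Reasoning
    Hw≤Gw : deg H w ≤ deg G w
    Hw≤Gw = begin
      deg H w                   ≡⟨ degH w ⟩
      𝟙 (w ∈? g) + D w          ≤⟨ +-monoˡ-≤ (D w) (𝟙-mono (w ∈? g) (w ∈? f) (∈g⇒∈f w≢b)) ⟩
      𝟙 (w ∈? f) + D w          ≤⟨ +-monoˡ-≤ (D w) (m≤m*n (𝟙 (w ∈? f)) c) ⟩
      𝟙 (w ∈? f) * c + D w      ≡⟨ +-comm _ (D w) ⟩
      D w + 𝟙 (w ∈? f) * c      ≡⟨ degG w ⟨
      deg G w                   ∎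

Connected∧Uniform⇒2≤m : ∀ {n m} {E : Hypergraph n} → Connected E → Uniform m E
  → ∀ {u v} → u ≢ v → 2 ≤ m
Connected∧Uniform⇒2≤m conn unif {u} {v} u≢v
  with e , e∈E , 2≤∣e∣ ← walk⇒edge-of-size≥2 (conn u v) u≢v = subst (2 ≤_) (All.lookup unif e∈E) 2≤∣e∣

module _ {N n n₁ n₂} {ι : Fin n → Fin N} {ι₁ : Fin n₁ → Fin N} {ι₂ : Fin n₂ → Fin N}
         {u v u₀ v₀} (gl : IsGluing ι ι₁ ι₂ u v u₀ v₀) where

  open IsGluing gl

  ι₂[w]∉image₁ : ∀ s w → ι₂ w ∉ image ι₁ s
  ι₂[w]∉image₁ s w ι₂w∈ with x , _ , ι₁x≡ι₂w ← image⁻ ι₁ s ι₂w∈ = disj₁₂ x w ι₁x≡ι₂w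

  image≢image₁ : ∀ e {s x} → x ∈ s → x ≢ u₀ → image ι e ≢ image ι₁ s
  image≢image₁ e {s} {x} x∈s x≢u₀ eq
    with y , _ , ιy≡ι₁x ← image⁻ ι e (subst (ι₁ x ∈_) (sym eq) (image⁺ ι₁ s x∈s))
    = x≢u₀ (only₁ x y (sym ιy≡ι₁x))

lemma2p5 : {m n n₁ n₂ N : ℕ}
    → (E : Hypergraph n) (T₁ : Hypergraph n₁) (T₂ : Hypergraph n₂)
    → (u v : Fin n)
    → Connected E → Uniform m E → Unique E
    → u ≢ v → 1 < deg E u → deg E v ≤ deg E u
    → Hypertree m T₁ → Binary T₁ → 0 < length T₁
    → Hypertree m T₂ → Binary T₂
    → (u₀ : Fin n₁) → PendentVertex T₁ u₀
    → (e₀ : Subset n₁) → e₀ ∈ₑ T₁ → u₀ ∈ e₀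
    → (v₀ : Fin n₂) → (0 < length T₂ → PendentVertex T₂ v₀)
    → (ι : Fin n → Fin N) (ι₁ : Fin n₁ → Fin N) (ι₂ : Fin n₂ → Fin N)
    → IsGluing ι ι₁ ι₂ u v u₀ v₀
    → (vₜ : Fin N) → ∃ (λ w → ι₂ w ≡ vₜ)
    → PendentVertex (glueEdges ι ι₁ ι₂ E T₁ T₂) vₜ
    → (0 < length T₂
         → Zagreb (replaceEdge (glueEdges ι ι₁ ι₂ E T₁ T₂) (image ι₁ e₀)
                      ((image ι₁ e₀ - ι u) ∪ ⁅ vₜ ⁆))
           < Zagreb (glueEdges ι ι₁ ι₂ E T₁ T₂))
      × (length T₂ ≡ 0 → deg E v < deg E u
         → Zagreb (replaceEdge (glueEdges ι ι₁ ι₂ E T₁ T₂) (image ι₁ e₀)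
                      ((image ι₁ e₀ - ι u) ∪ ⁅ vₜ ⁆))
           < Zagreb (glueEdges ι ι₁ ι₂ E T₁ T₂))
lemma2p5 E T₁ T₂ u v conn unif _ u≢v 1<d[u] _ (_ , unif₁ , _) _ _ _ _ u₀ _ e₀ e₀∈T₁ u₀∈e₀ _ _
  ι ι₁ ι₂ gl vₜ (wₜ , refl) (vₜ-core , _) = (λ _ → decrease) , (λ _ _ → decrease)
  where
  open IsGluing gl
  G = glueEdges ι ι₁ ι₂ E T₁ T₂
  f = image ι₁ e₀
  D = deg (dropEdge f G)

  f∈G : f ∈ₑ G
  f∈G = ∈-++⁺ʳ (map (image ι) E) (∈-++⁺ˡ (∈-map⁺ (image ι₁) e₀∈T₁))

  2≤∣e₀∣ : 2 ≤ ∣ e₀ ∣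
  2≤∣e₀∣ = subst (2 ≤_) (sym (All.lookup unif₁ e₀∈T₁)) (Connected∧Uniform⇒2≤m conn unif u≢v)

  E-edges≢f : All (_≢ f) (map (image ι) E)
  E-edges≢f with x , x∈e₀ , x≢u₀ ← 2≤∣p∣⇒∃x∈p∧x≢y 2≤∣e₀∣ u₀
    = map⁺ (All.universal (λ e → image≢image₁ gl e x∈e₀ x≢u₀) E)

  D[vₜ]<D[ιu] : D vₜ < D (ι u)
  D[vₜ]<D[ιu] = begin-strict
    D vₜ                            ≡⟨ deg-dropEdge-∉ G (ι₂[w]∉image₁ gl e₀ wₜ) ⟩
    deg G vₜ                        ≡⟨ vₜ-core ⟩
    1                               <⟨ 1<d[u] ⟩
    deg E u                         ≤⟨ deg≤deg-map-image ι E u ⟩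
    deg (map (image ι) E) (ι u)     ≤⟨ deg≤deg-dropEdge-++ _ E-edges≢f (ι u) ⟩
    D (ι u)                         ∎
    where open ≤-Reasoning

  decrease : Zagreb (replaceEdge G f ((f - ι u) ∪ ⁅ ι₂ wₜ ⁆)) < Zagreb G
  decrease = zagreb-replaceEdge-< G f∈G (subst (_∈ f) glue₁ (image⁺ ι₁ e₀ u₀∈e₀)) (ι₂[w]∉image₁ gl e₀ wₜ) D[vₜ]<D[ιu]
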